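{- Let $n\ge2$ and $0<k\le n/2$. A $k$-root is positive if and only if it can be written in the form $\prod_{r=1}^k(x_{i_{2r-1}}\pm x_{i_{2r}})$ where $i_{2r-1}<i_{2r}$ for all $r$.
   Context: $V_{n,k}$ is the $\mathbb{Q}$-vector space with basis the squarefree degree-$k$ monomials $x_I=\prod_{i\in I}x_i$ in $x_1,\dots,x_n$. Monomials are ordered lexicographically: for distinct $k$-subsets $I,J$ with $t=\min(I\,\Delta\,J)$, $x_I\prec x_J$ iff $t\in I$. A nonzero $v\in V_{n,k}$ is positive if the $\prec$-minimal monomial appearing in $v$ has positive coefficient. A $k$-root is an element of $V_{n,k}$ of the form $\prod_{r=1}^k(\pm x_{i_{2r-1}}\pm x_{i_{2r}})$, with signs chosen independently and $i_1,\dots,i_{2k}$ distinct indices in $\{1,\dots,n\}$; it is positive if it is a positive element of $V_{n,k}$. -}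

module Defs where

open import Data.Nat as ℕ using (ℕ; zero; suc; _∸_)
open import Data.Fin using (Fin)
import Data.Fin as Fin
open import Data.Vec using (Vec; []; _∷_; zipWith)
open import Data.Vec.Properties using (≡-dec)
open import Data.List using (List; []; _∷_; map; concatMap; upTo)
open import Data.Rational using (ℚ; 0ℚ; 1ℚ; -_; _+_; _*_; _<_)
open import Data.Sign using (Sign)
open import Data.Product using (Σ; _×_; ∃)
open import Relation.Nullary using (yes; no)
open import Relation.Binary.PropositionalEquality using (_≡_; _≢_)

-- Polynomials in x_0,…,x_{n-1} over ℚ, as coefficient functions on
-- exponent vectors (monomials).  Equality of polynomials is pointwise.
Mono : ℕ → Set
Mono n = Vec ℕ n

Poly : ℕ → Set
Poly n = Mono n → ℚ

_≈ₚ_ : ∀ {n} → Poly n → Poly n → Set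
f ≈ₚ g = ∀ α → f α ≡ g α

unitMono : ∀ {n} → Fin n → Mono n
unitMono {suc n} Fin.zero    = 1 ∷ Data.Vec.replicate n 0
unitMono {suc n} (Fin.suc i) = 0 ∷ unitMono i

monoP : ∀ {n} → Mono n → Poly n
monoP β α with ≡-dec ℕ._≟_ α β
... | yes _ = 1ℚ
... | no  _ = 0ℚ

var : ∀ {n} → Fin n → Poly n
var i = monoP (unitMono i)

oneP : ∀ {n} → Poly n
oneP = monoP (Data.Vec.replicate _ 0)

_+ₚ_ : ∀ {n} → Poly n → Poly n → Poly n
(f +ₚ g) α = f α + g α

_·ₚ_ : ∀ {n} → ℚ → Poly n → Poly n
(c ·ₚ f) α = c * f α

below : ∀ {n} → Mono n → List (Mono n)
below []      = [] ∷ []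
below (a ∷ α) = concatMap (λ b → map (b ∷_) (below α)) (upTo (suc a))

sumℚ : List ℚ → ℚ
sumℚ []       = 0ℚ
sumℚ (x ∷ xs) = x + sumℚ xs

_*ₚ_ : ∀ {n} → Poly n → Poly n → Poly n
(f *ₚ g) α = sumℚ (map (λ β → f β * g (zipWith _∸_ α β)) (below α))

prodP : ∀ {n} (k : ℕ) → (Fin k → Poly n) → Poly n
prodP zero    f = oneP
prodP (suc k) f = f Fin.zero *ₚ prodP k (λ r → f (Fin.suc r))

signℚ : Sign → ℚ
signℚ Sign.+ = 1ℚ
signℚ Sign.- = - 1ℚ

-- indices i_1,…,i_{2k} are encoded as a r = i_{2r-1}, b r = i_{2r};
-- they are all distinct
Distinct : ∀ {n k} → (Fin k → Fin n) → (Fin k → Fin n) → Set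
Distinct a b = (∀ r s → a r ≡ a s → r ≡ s)
             × (∀ r s → b r ≡ b s → r ≡ s)
             × (∀ r s → a r ≢ b s)

rootProd : ∀ {n} (k : ℕ) → (Fin k → Fin n) → (Fin k → Fin n)
         → (Fin k → Sign) → (Fin k → Sign) → Poly n
rootProd k a b σ τ =
  prodP k (λ r → (signℚ (σ r) ·ₚ var (a r)) +ₚ (signℚ (τ r) ·ₚ var (b r)))

IsKRoot : ∀ {n} (k : ℕ) → Poly n → Set
IsKRoot {n} k v =
  ∃ λ (a : Fin k → Fin n) → ∃ λ (b : Fin k → Fin n) →
  ∃ λ (σ : Fin k → Sign) → ∃ λ (τ : Fin k → Sign) →
  Distinct a b × (v ≈ₚ rootProd k a b σ τ)

-- lexicographic order: α ≺ β iff at the first position t where they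
-- differ, α has the larger exponent (for squarefree monomials: t ∈ I).
data _≺_ : ∀ {n} → Mono n → Mono n → Set where
  here  : ∀ {n a b} {α β : Mono n} → b ℕ.< a → (a ∷ α) ≺ (b ∷ β)
  there : ∀ {n a} {α β : Mono n} → α ≺ β → (a ∷ α) ≺ (a ∷ β)

Positive : ∀ {n} → Poly n → Set
Positive v = ∃ λ α → (0ℚ < v α) × (∀ β → β ≺ α → v β ≡ 0ℚ)

-- Ordering the two terms of each factor (±x_i ± x_j) so that i < j and pulling out the sign
-- of the first one writes every k-root as ± a normal root ∏_r (x_{a_r} ± x_{b_r}) with
-- a_r < b_r.  Expanding a normal root, its ≺-least monomial is x_{a_1} ⋯ x_{a_k}, obtained
-- by choosing x_{a_r} in every factor, with coefficient 1: choosing some x_{b_r} instead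
-- replaces a variable by a later one.  Hence normal roots are positive and their negatives
-- are not.
module Submission where

open import Defs
open import Data.Nat as ℕ using (ℕ; zero; suc; _∸_; _≤_; _<_; _*_; z≤n; s≤s)
import Data.Nat.Properties as ℕₚ
open import Data.Fin using (Fin)
import Data.Fin as F
import Data.Fin.Properties as Fₚ
open import Data.Vec using (Vec; []; _∷_; zipWith; lookup; replicate)
open import Data.Vec.Properties using (≡-dec; zipWith-identityˡ; zipWith-identityʳ; lookup-replicate)
open import Data.Vec.Relation.Binary.Pointwise.Inductive using (Pointwise; []; _∷_)
open import Data.List using (List; []; _∷_; map; concatMap; upTo; _++_)
open import Data.List.Properties using (map-cong; map-∘; map-++; map-upTo; map-applyUpTo)
import Data.Rational as ℚ
open ℚ using (ℚ; 0ℚ; 1ℚ; -_; _+_; *<*) renaming (_*_ to _·_)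
open import Data.Rational.Properties
  using (+-identityˡ; +-identityʳ; +-assoc; +-comm; *-zeroˡ; *-zeroʳ; *-identityˡ; *-assoc; *-comm;
         *-distribˡ-+; *-distribʳ-+; <-irrefl; positive⁻¹)
open import Data.Rational.Solver using (module +-*-Solver)
open import Data.Sign as S using (Sign)
import Data.Sign.Properties as Sₚ
open import Data.Bool using (Bool; true; false; if_then_else_; not)
open import Data.Product using (_×_; ∃; _,_; proj₁; proj₂)
open import Data.Sum using (_⊎_; inj₁; inj₂)
open import Data.Empty using (⊥; ⊥-elim)
open import Relation.Nullary using (¬_; yes; no; isYes)
open import Relation.Binary using (tri<; tri≈; tri>)
open import Relation.Binary.PropositionalEquality
open import Function using (_∘_)

private
  variable
    A B : Set
    n : ℕ

sumℚ-++ : ∀ xs ys → sumℚ (xs ++ ys) ≡ sumℚ xs + sumℚ ys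
sumℚ-++ []       ys = sym (+-identityˡ _)
sumℚ-++ (x ∷ xs) ys = trans (cong (x +_) (sumℚ-++ xs ys)) (sym (+-assoc x _ _))

sumℚ-concatMap : ∀ (f : B → ℚ) (F : A → List B) xs →
  sumℚ (map f (concatMap F xs)) ≡ sumℚ (map (λ x → sumℚ (map f (F x))) xs)
sumℚ-concatMap f F []       = refl
sumℚ-concatMap f F (x ∷ xs) = begin
  sumℚ (map f (F x ++ concatMap F xs))            ≡⟨ cong sumℚ (map-++ f (F x) _) ⟩
  sumℚ (map f (F x) ++ map f (concatMap F xs))    ≡⟨ sumℚ-++ (map f (F x)) _ ⟩
  sumℚ (map f (F x)) + sumℚ (map f (concatMap F xs))
    ≡⟨ cong (sumℚ (map f (F x)) +_) (sumℚ-concatMap f F xs) ⟩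
  sumℚ (map f (F x)) + sumℚ (map (λ y → sumℚ (map f (F y))) xs) ∎
  where open ≡-Reasoning

sumℚ-cong : ∀ {f g : A → ℚ} → (∀ x → f x ≡ g x) → ∀ xs → sumℚ (map f xs) ≡ sumℚ (map g xs)
sumℚ-cong f≗g xs = cong sumℚ (map-cong f≗g xs)

sumℚ-zero : ∀ {f : A → ℚ} → (∀ x → f x ≡ 0ℚ) → ∀ xs → sumℚ (map f xs) ≡ 0ℚ
sumℚ-zero f≗0 []       = refl
sumℚ-zero f≗0 (x ∷ xs) rewrite f≗0 x | sumℚ-zero f≗0 xs = refl

sumℚ-·ˡ : ∀ c (f : A → ℚ) xs → sumℚ (map (λ x → c · f x) xs) ≡ c · sumℚ (map f xs)
sumℚ-·ˡ c f []       = sym (*-zeroʳ c)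
sumℚ-·ˡ c f (x ∷ xs) rewrite sumℚ-·ˡ c f xs = sym (*-distribˡ-+ c (f x) _)

sumℚ-+ : ∀ (f g : A → ℚ) xs →
  sumℚ (map (λ x → f x + g x) xs) ≡ sumℚ (map f xs) + sumℚ (map g xs)
sumℚ-+ f g []       = refl
sumℚ-+ f g (x ∷ xs) rewrite sumℚ-+ f g xs = interchange (f x) (g x) _ _
  where
  open +-*-Solver
  interchange : ∀ a b c d → (a + b) + (c + d) ≡ (a + c) + (b + d)
  interchange = solve 4 (λ a b c d → (a :+ b) :+ (c :+ d) := (a :+ c) :+ (b :+ d)) refl

sumℚ-upTo-suc : ∀ (G : ℕ → ℚ) m →
  sumℚ (map G (upTo (suc m))) ≡ G 0 + sumℚ (map (G ∘ suc) (upTo m))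
sumℚ-upTo-suc G m =
  cong (λ xs → G 0 + sumℚ xs) (trans (map-applyUpTo suc G m) (sym (map-upTo (G ∘ suc) m)))

SupportedAt : (A → ℚ) → A → Set
SupportedAt f a = ∀ x → x ≢ a → f x ≡ 0ℚ

supportedAt-suc : ∀ {G : ℕ → ℚ} {c} → SupportedAt G (suc c) → SupportedAt (G ∘ suc) c
supportedAt-suc G-supp x x≢c = G-supp (suc x) (x≢c ∘ ℕₚ.suc-injective)

sumℚ-upTo-point : ∀ (G : ℕ → ℚ) c → SupportedAt G c → ∀ m → c < m →
  sumℚ (map G (upTo m)) ≡ G c
sumℚ-upTo-point G zero G-supp (suc m) _ = begin
  sumℚ (map G (upTo (suc m)))           ≡⟨ sumℚ-upTo-suc G m ⟩
  G 0 + sumℚ (map (G ∘ suc) (upTo m))   ≡⟨ cong (G 0 +_) (sumℚ-zero (λ x → G-supp (suc x) λ ()) (upTo m)) ⟩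
  G 0 + 0ℚ                              ≡⟨ +-identityʳ (G 0) ⟩
  G 0                                   ∎
  where open ≡-Reasoning
sumℚ-upTo-point G (suc c) G-supp (suc m) (s≤s c<m) = begin
  sumℚ (map G (upTo (suc m)))           ≡⟨ sumℚ-upTo-suc G m ⟩
  G 0 + sumℚ (map (G ∘ suc) (upTo m))   ≡⟨ cong (_+ sumℚ (map (G ∘ suc) (upTo m))) (G-supp 0 λ ()) ⟩
  0ℚ + sumℚ (map (G ∘ suc) (upTo m))    ≡⟨ +-identityˡ _ ⟩
  sumℚ (map (G ∘ suc) (upTo m))         ≡⟨ sumℚ-upTo-point (G ∘ suc) c (supportedAt-suc G-supp) m c<m ⟩
  G (suc c)                             ∎
  where open ≡-Reasoning

sumℚ-upTo-outside : ∀ (G : ℕ → ℚ) c → SupportedAt G c → ∀ m → m ≤ c →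
  sumℚ (map G (upTo m)) ≡ 0ℚ
sumℚ-upTo-outside G c       G-supp zero    _         = refl
sumℚ-upTo-outside G (suc c) G-supp (suc m) (s≤s m≤c) = begin
  sumℚ (map G (upTo (suc m)))           ≡⟨ sumℚ-upTo-suc G m ⟩
  G 0 + sumℚ (map (G ∘ suc) (upTo m))   ≡⟨ cong (_+ sumℚ (map (G ∘ suc) (upTo m))) (G-supp 0 λ ()) ⟩
  0ℚ + sumℚ (map (G ∘ suc) (upTo m))    ≡⟨ +-identityˡ _ ⟩
  sumℚ (map (G ∘ suc) (upTo m))         ≡⟨ sumℚ-upTo-outside (G ∘ suc) c (supportedAt-suc G-supp) m m≤c ⟩
  0ℚ                                    ∎
  where open ≡-Reasoning

_∣ₘ_ : Mono n → Mono n → Set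
_∣ₘ_ = Pointwise _≤_

∷-injective : ∀ {x y : ℕ} {xs ys : Vec ℕ n} → (x ∷ xs) ≡ (y ∷ ys) → x ≡ y × xs ≡ ys
∷-injective refl = refl , refl

sumℚ-below-∷ : ∀ (f : Mono (suc n) → ℚ) a α →
  sumℚ (map f (below (a ∷ α))) ≡ sumℚ (map (λ b → sumℚ (map (f ∘ (b ∷_)) (below α))) (upTo (suc a)))
sumℚ-below-∷ f a α =
  trans (sumℚ-concatMap f (λ b → map (b ∷_) (below α)) (upTo (suc a)))
        (sumℚ-cong (λ b → cong sumℚ (sym (map-∘ (below α)))) (upTo (suc a)))

module _ {f : Mono (suc n) → ℚ} {c γ} (f-supp : SupportedAt f (c ∷ γ)) (α : Mono n) where

  column-supportedAt : SupportedAt (λ b → sumℚ (map (f ∘ (b ∷_)) (below α))) c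
  column-supportedAt b b≢c = sumℚ-zero (λ β → f-supp (b ∷ β) (b≢c ∘ proj₁ ∘ ∷-injective)) (below α)

  row-supportedAt : SupportedAt (f ∘ (c ∷_)) γ
  row-supportedAt β β≢γ = f-supp (c ∷ β) (β≢γ ∘ proj₂ ∘ ∷-injective)

sumℚ-below-divisor : ∀ (α γ : Mono n) (f : Mono n → ℚ) → SupportedAt f γ → γ ∣ₘ α →
  sumℚ (map f (below α)) ≡ f γ
sumℚ-below-divisor []      []      f f-supp []          = +-identityʳ _
sumℚ-below-divisor (a ∷ α) (c ∷ γ) f f-supp (c≤a ∷ γ∣α) =
  trans (sumℚ-below-∷ f a α)
  (trans (sumℚ-upTo-point _ c (column-supportedAt f-supp α) (suc a) (s≤s c≤a))
         (sumℚ-below-divisor α γ (f ∘ (c ∷_)) (row-supportedAt f-supp α) γ∣α))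

sumℚ-below-nondivisor : ∀ (α γ : Mono n) (f : Mono n → ℚ) → SupportedAt f γ → ¬ γ ∣ₘ α →
  sumℚ (map f (below α)) ≡ 0ℚ
sumℚ-below-nondivisor []      []      f f-supp γ∤α = ⊥-elim (γ∤α [])
sumℚ-below-nondivisor (a ∷ α) (c ∷ γ) f f-supp γ∤α with c ℕₚ.≤? a
... | yes c≤a =
  trans (sumℚ-below-∷ f a α)
  (trans (sumℚ-upTo-point _ c (column-supportedAt f-supp α) (suc a) (s≤s c≤a))
         (sumℚ-below-nondivisor α γ (f ∘ (c ∷_)) (row-supportedAt f-supp α) (γ∤α ∘ (c≤a ∷_))))
... | no c≰a =
  trans (sumℚ-below-∷ f a α)
        (sumℚ-upTo-outside _ c (column-supportedAt f-supp α) (suc a) (ℕₚ.≰⇒> c≰a))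

incr : Fin n → Mono n → Mono n
incr i γ = zipWith ℕ._+_ (unitMono i) γ

decr : Mono n → Fin n → Mono n
decr α i = zipWith _∸_ α (unitMono i)

zipWith-+-zeros : ∀ (γ : Mono n) → zipWith ℕ._+_ (replicate n 0) γ ≡ γ
zipWith-+-zeros = zipWith-identityˡ ℕₚ.+-identityˡ

zipWith-∸-zeros : ∀ (γ : Mono n) → zipWith _∸_ γ (replicate n 0) ≡ γ
zipWith-∸-zeros = zipWith-identityʳ λ _ → refl

decr-incr : ∀ (i : Fin n) γ → decr (incr i γ) i ≡ γ
decr-incr F.zero    (x ∷ γ) =
  cong (x ∷_) (trans (cong (λ δ → zipWith _∸_ δ (replicate _ 0)) (zipWith-+-zeros γ)) (zipWith-∸-zeros γ))
decr-incr (F.suc i) (x ∷ γ) = cong (x ∷_) (decr-incr i γ)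

lookup-incr-≡ : ∀ (i : Fin n) γ → lookup (incr i γ) i ≡ suc (lookup γ i)
lookup-incr-≡ F.zero    (x ∷ γ) = refl
lookup-incr-≡ (F.suc i) (x ∷ γ) = lookup-incr-≡ i γ

lookup-incr-≢ : ∀ (i j : Fin n) γ → i ≢ j → lookup (incr i γ) j ≡ lookup γ j
lookup-incr-≢ F.zero    F.zero    γ       i≢j = ⊥-elim (i≢j refl)
lookup-incr-≢ F.zero    (F.suc j) (x ∷ γ) i≢j = cong (λ δ → lookup δ j) (zipWith-+-zeros γ)
lookup-incr-≢ (F.suc i) F.zero    (x ∷ γ) i≢j = refl
lookup-incr-≢ (F.suc i) (F.suc j) (x ∷ γ) i≢j = lookup-incr-≢ i j γ (i≢j ∘ cong F.suc)

zeros-∣ₘ : ∀ (α : Mono n) → replicate n 0 ∣ₘ α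
zeros-∣ₘ []      = []
zeros-∣ₘ (a ∷ α) = z≤n ∷ zeros-∣ₘ α

unitMono-∣ₘ : ∀ (α : Mono n) i {m} → lookup α i ≡ suc m → unitMono i ∣ₘ α
unitMono-∣ₘ (a ∷ α) F.zero    refl = s≤s z≤n ∷ zeros-∣ₘ α
unitMono-∣ₘ (a ∷ α) (F.suc i) αᵢ≡1+m = z≤n ∷ unitMono-∣ₘ α i αᵢ≡1+m

unitMono-∤ : ∀ (α : Mono n) i → lookup α i ≡ 0 → ¬ unitMono i ∣ₘ α
unitMono-∤ (a ∷ α) F.zero    refl (() ∷ _)
unitMono-∤ (a ∷ α) (F.suc i) αᵢ≡0 (_ ∷ eᵢ∣α) = unitMono-∤ α i αᵢ≡0 eᵢ∣α

≺-irrefl : ∀ {β γ : Mono n} → β ≺ γ → β ≢ γ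
≺-irrefl (here b<a) refl = ℕₚ.<-irrefl refl b<a
≺-irrefl (there β≺γ) refl = ≺-irrefl β≺γ refl

≺-trichotomy : ∀ (α β : Mono n) → α ≺ β ⊎ α ≡ β ⊎ β ≺ α
≺-trichotomy []      []      = inj₂ (inj₁ refl)
≺-trichotomy (x ∷ α) (y ∷ β) with ℕₚ.<-cmp x y
... | tri< x<y _ _ = inj₂ (inj₂ (here x<y))
... | tri> _ _ y<x = inj₁ (here y<x)
... | tri≈ _ refl _ with ≺-trichotomy α β
...   | inj₁ α≺β         = inj₁ (there α≺β)
...   | inj₂ (inj₁ refl) = inj₂ (inj₁ refl)
...   | inj₂ (inj₂ β≺α)  = inj₂ (inj₂ (there β≺α))

decr-≺ : ∀ (β γ : Mono n) i {m m'} → β ≺ γ → lookup β i ≡ suc m → lookup γ i ≡ suc m' →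
  decr β i ≺ decr γ i
decr-≺ (x ∷ β) (y ∷ γ) F.zero    (here y<x) _ refl = here (ℕₚ.∸-monoˡ-< y<x (s≤s z≤n))
decr-≺ (x ∷ β) (_ ∷ γ) F.zero    (there β≺γ) _ _
  rewrite zipWith-∸-zeros β | zipWith-∸-zeros γ = there β≺γ
decr-≺ (x ∷ β) (y ∷ γ) (F.suc i) (here y<x) _ _ = here y<x
decr-≺ (x ∷ β) (_ ∷ γ) (F.suc i) (there β≺γ) βᵢ≡1+m γᵢ≡1+m' = there (decr-≺ β γ i β≺γ βᵢ≡1+m γᵢ≡1+m')

decr-≺-incr : ∀ (β γ : Mono n) (i j : Fin n) → i F.< j → β ≺ incr i γ → decr β j ≺ γ
decr-≺-incr (x ∷ β) (y ∷ γ) F.zero    (F.suc j) _ (here 1+y<x) = here (ℕₚ.<-trans (ℕₚ.n<1+n y) 1+y<x)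
decr-≺-incr (x ∷ β) (y ∷ γ) F.zero    (F.suc j) _ (there _)    = here (ℕₚ.n<1+n y)
decr-≺-incr (x ∷ β) (y ∷ γ) (F.suc i) (F.suc j) _ (here y<x)   = here y<x
decr-≺-incr (x ∷ β) (y ∷ γ) (F.suc i) (F.suc j) (s≤s i<j) (there β≺γ) = there (decr-≺-incr β γ i j i<j β≺γ)

monoP-≡ : ∀ (β : Mono n) → monoP β β ≡ 1ℚ
monoP-≡ β with ≡-dec ℕ._≟_ β β
... | yes _   = refl
... | no β≢β = ⊥-elim (β≢β refl)

monoP-≢ : ∀ (β α : Mono n) → α ≢ β → monoP β α ≡ 0ℚ
monoP-≢ β α α≢β with ≡-dec ℕ._≟_ α β
... | yes α≡β = ⊥-elim (α≢β α≡β)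
... | no _    = refl

var-*ₚ-supportedAt : ∀ (i : Fin n) (g : Poly n) α →
  SupportedAt (λ β → monoP (unitMono i) β · g (zipWith _∸_ α β)) (unitMono i)
var-*ₚ-supportedAt i g α β β≢eᵢ rewrite monoP-≢ (unitMono i) β β≢eᵢ = *-zeroˡ (g (zipWith _∸_ α β))

var-*ₚ-suc : ∀ (i : Fin n) (g : Poly n) α {m} → lookup α i ≡ suc m → (var i *ₚ g) α ≡ g (decr α i)
var-*ₚ-suc i g α αᵢ≡1+m = begin
  (var i *ₚ g) α                 ≡⟨ sumℚ-below-divisor α (unitMono i) _ (var-*ₚ-supportedAt i g α)
                                                       (unitMono-∣ₘ α i αᵢ≡1+m) ⟩
  var i (unitMono i) · g (decr α i) ≡⟨ cong (_· g (decr α i)) (monoP-≡ (unitMono i)) ⟩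
  1ℚ · g (decr α i)              ≡⟨ *-identityˡ _ ⟩
  g (decr α i)                   ∎
  where open ≡-Reasoning

var-*ₚ-zero : ∀ (i : Fin n) (g : Poly n) α → lookup α i ≡ 0 → (var i *ₚ g) α ≡ 0ℚ
var-*ₚ-zero i g α αᵢ≡0 =
  sumℚ-below-nondivisor α (unitMono i) _ (var-*ₚ-supportedAt i g α) (unitMono-∤ α i αᵢ≡0)

*ₚ-cong : ∀ {f f′ g g′ : Poly n} → f ≈ₚ f′ → g ≈ₚ g′ → (f *ₚ g) ≈ₚ (f′ *ₚ g′)
*ₚ-cong f≈f′ g≈g′ α = sumℚ-cong (λ β → cong₂ _·_ (f≈f′ β) (g≈g′ _)) (below α)

*ₚ-scaleˡ : ∀ c (f g : Poly n) → ((c ·ₚ f) *ₚ g) ≈ₚ (c ·ₚ (f *ₚ g))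
*ₚ-scaleˡ c f g α = trans (sumℚ-cong (λ β → *-assoc c (f β) _) (below α)) (sumℚ-·ˡ c _ (below α))

*ₚ-scaleʳ : ∀ c (f g : Poly n) → (f *ₚ (c ·ₚ g)) ≈ₚ (c ·ₚ (f *ₚ g))
*ₚ-scaleʳ c f g α = trans (sumℚ-cong (λ β → x·[c·y]≡c·[x·y] (f β) _) (below α)) (sumℚ-·ˡ c _ (below α))
  where
  x·[c·y]≡c·[x·y] : ∀ x y → x · (c · y) ≡ c · (x · y)
  x·[c·y]≡c·[x·y] x y = trans (sym (*-assoc x c y)) (trans (cong (_· y) (*-comm x c)) (*-assoc c x y))

*ₚ-distribʳ-+ₚ : ∀ (f g h : Poly n) → ((f +ₚ g) *ₚ h) ≈ₚ ((f *ₚ h) +ₚ (g *ₚ h))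
*ₚ-distribʳ-+ₚ f g h α =
  trans (sumℚ-cong (λ β → *-distribʳ-+ (h (zipWith _∸_ α β)) (f β) (g β)) (below α)) (sumℚ-+ _ _ (below α))

linear-*ₚ : ∀ s t (i j : Fin n) (g : Poly n) β →
  (((s ·ₚ var i) +ₚ (t ·ₚ var j)) *ₚ g) β ≡ s · (var i *ₚ g) β + t · (var j *ₚ g) β
linear-*ₚ s t i j g β =
  trans (*ₚ-distribʳ-+ₚ (s ·ₚ var i) (t ·ₚ var j) g β)
        (cong₂ _+_ (*ₚ-scaleˡ s (var i) g β) (*ₚ-scaleˡ t (var j) g β))

prodP-cong : ∀ k (f g : Fin k → Poly n) → (∀ r → f r ≈ₚ g r) → prodP k f ≈ₚ prodP k g
prodP-cong zero    f g f≈g α = refl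
prodP-cong (suc k) f g f≈g = *ₚ-cong (f≈g F.zero) (prodP-cong k (f ∘ F.suc) (g ∘ F.suc) (f≈g ∘ F.suc))

signProd : ∀ k → (Fin k → Sign) → Sign
signProd zero    ε = S.+
signProd (suc k) ε = ε F.zero S.* signProd k (ε ∘ F.suc)

signℚ-* : ∀ s t → signℚ (s S.* t) ≡ signℚ s · signℚ t
signℚ-* S.+ S.+ = refl
signℚ-* S.+ S.- = refl
signℚ-* S.- S.+ = refl
signℚ-* S.- S.- = refl

signℚ-sq : ∀ s → signℚ s · signℚ s ≡ 1ℚ
signℚ-sq S.+ = refl
signℚ-sq S.- = refl

prodP-scale : ∀ k (ε : Fin k → Sign) (f : Fin k → Poly n) →
  prodP k (λ r → signℚ (ε r) ·ₚ f r) ≈ₚ (signℚ (signProd k ε) ·ₚ prodP k f)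
prodP-scale zero    ε f α = sym (*-identityˡ _)
prodP-scale (suc k) ε f α = begin
  ((s₀ ·ₚ f F.zero) *ₚ prodP k (λ r → signℚ (ε (F.suc r)) ·ₚ f (F.suc r))) α
    ≡⟨ *ₚ-cong {f = s₀ ·ₚ f F.zero} (λ _ → refl) (prodP-scale k (ε ∘ F.suc) (f ∘ F.suc)) α ⟩
  ((s₀ ·ₚ f F.zero) *ₚ (s′ ·ₚ R)) α    ≡⟨ *ₚ-scaleˡ s₀ (f F.zero) (s′ ·ₚ R) α ⟩
  s₀ · (f F.zero *ₚ (s′ ·ₚ R)) α       ≡⟨ cong (s₀ ·_) (*ₚ-scaleʳ s′ (f F.zero) R α) ⟩
  s₀ · (s′ · (f F.zero *ₚ R) α)        ≡⟨ sym (*-assoc s₀ s′ _) ⟩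
  (s₀ · s′) · (f F.zero *ₚ R) α        ≡⟨ cong (_· (f F.zero *ₚ R) α) (sym (signℚ-* (ε F.zero) _)) ⟩
  signℚ (signProd (suc k) ε) · (f F.zero *ₚ R) α ∎
  where
  open ≡-Reasoning
  s₀ = signℚ (ε F.zero)
  s′ = signℚ (signProd k (ε ∘ F.suc))
  R = prodP k (f ∘ F.suc)

MonicAt : Mono n → Poly n → Set
MonicAt I P = P I ≡ 1ℚ × (∀ β → β ≺ I → P β ≡ 0ℚ)

MonicAt-resp-≈ₚ : ∀ {I : Mono n} {P Q} → P ≈ₚ Q → MonicAt I Q → MonicAt I P
MonicAt-resp-≈ₚ P≈Q (Q-I≡1 , Q-below≡0) = trans (P≈Q _) Q-I≡1 , λ β β≺I → trans (P≈Q β) (Q-below≡0 β β≺I)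

MonicAt⇒Positive : ∀ {I : Mono n} {P} → MonicAt I P → Positive P
MonicAt⇒Positive {I = I} (P-I≡1 , P-below≡0) =
  I , subst (0ℚ ℚ.<_) (sym P-I≡1) (positive⁻¹ 1ℚ) , P-below≡0

MonicAt⇒¬Positive-neg : ∀ {I : Mono n} {P} → MonicAt I P → ¬ Positive ((- 1ℚ) ·ₚ P)
MonicAt⇒¬Positive-neg {I = I} {P} (P-I≡1 , P-below≡0) (α , 0<-Pα , -P-below≡0) =
  refute (≺-trichotomy α I)
  where
  -P-I≡-1 : - 1ℚ · P I ≡ - 1ℚ
  -P-I≡-1 = cong (- 1ℚ ·_) P-I≡1
  -P-below : ∀ β → β ≺ I → - 1ℚ · P β ≡ 0ℚ
  -P-below β β≺I = trans (cong (- 1ℚ ·_) (P-below≡0 β β≺I)) (*-zeroʳ (- 1ℚ))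
  0≮-1 : ¬ 0ℚ ℚ.< - 1ℚ
  0≮-1 (*<* ())
  -1≢0 : - 1ℚ ≢ 0ℚ
  -1≢0 ()
  refute : α ≺ I ⊎ α ≡ I ⊎ I ≺ α → ⊥
  refute (inj₁ α≺I)       = <-irrefl refl (subst (0ℚ ℚ.<_) (-P-below α α≺I) 0<-Pα)
  refute (inj₂ (inj₁ α≡I)) = 0≮-1 (subst (0ℚ ℚ.<_) (trans (cong (λ γ → - 1ℚ · P γ) α≡I) -P-I≡-1) 0<-Pα)
  refute (inj₂ (inj₂ I≺α)) = -1≢0 (trans (sym -P-I≡-1) (-P-below≡0 I I≺α))

leadingMono : ∀ k → (Fin k → Fin n) → Mono n
leadingMono {n} zero    a = replicate n 0
leadingMono     (suc k) a = incr (a F.zero) (leadingMono k (a ∘ F.suc))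

lookup-leadingMono-∉ : ∀ k (a : Fin k → Fin n) j → (∀ r → a r ≢ j) → lookup (leadingMono k a) j ≡ 0
lookup-leadingMono-∉ zero    a j a≢j = lookup-replicate j 0
lookup-leadingMono-∉ (suc k) a j a≢j =
  trans (lookup-incr-≢ (a F.zero) j _ (a≢j F.zero)) (lookup-leadingMono-∉ k (a ∘ F.suc) j (a≢j ∘ F.suc))

Distinct-tail : ∀ {k} {a b : Fin (suc k) → Fin n} → Distinct a b → Distinct (a ∘ F.suc) (b ∘ F.suc)
Distinct-tail (a-inj , b-inj , a≢b) =
  (λ r s → Fₚ.suc-injective ∘ a-inj _ _) , (λ r s → Fₚ.suc-injective ∘ b-inj _ _) , (λ r s → a≢b _ _)

NormalRoot : ∀ k → (Fin k → Fin n) → (Fin k → Fin n) → (Fin k → Sign) → Poly n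
NormalRoot k a b τ = rootProd k a b (λ _ → S.+) τ

-- At β ≺ x_a·I the coefficient of (x_a ± x_b)·Q combines coefficients of Q at β/x_a and β/x_b,
-- and both lie strictly below I (the second because a < b).
NormalRoot-monicAt : ∀ k (a b : Fin k → Fin n) τ → Distinct a b → (∀ r → a r F.< b r) →
  MonicAt (leadingMono k a) (NormalRoot k a b τ)
NormalRoot-monicAt {n} zero a b τ _ _ = monoP-≡ (replicate n 0) , λ β β≺0 → monoP-≢ _ β (≺-irrefl β≺0)
NormalRoot-monicAt (suc k) a b τ d@(_ , _ , a≢b) a<b = at-leading , below-leading
  where
  a₀ = a F.zero
  b₀ = b F.zero
  t = signℚ (τ F.zero)
  Q = NormalRoot k (a ∘ F.suc) (b ∘ F.suc) (τ ∘ F.suc)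
  I = leadingMono k (a ∘ F.suc)
  Q-monic : MonicAt I Q
  Q-monic = NormalRoot-monicAt k (a ∘ F.suc) (b ∘ F.suc) (τ ∘ F.suc) (Distinct-tail d) (a<b ∘ F.suc)

  b₀∉a₀I : lookup (incr a₀ I) b₀ ≡ 0
  b₀∉a₀I = trans (lookup-incr-≢ a₀ b₀ I (a≢b F.zero F.zero))
                 (lookup-leadingMono-∉ k (a ∘ F.suc) b₀ (λ r → a≢b (F.suc r) F.zero))

  at-leading : NormalRoot (suc k) a b τ (incr a₀ I) ≡ 1ℚ
  at-leading = begin
    NormalRoot (suc k) a b τ (incr a₀ I)                        ≡⟨ linear-*ₚ 1ℚ t a₀ b₀ Q (incr a₀ I) ⟩
    1ℚ · (var a₀ *ₚ Q) (incr a₀ I) + t · (var b₀ *ₚ Q) (incr a₀ I)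
      ≡⟨ cong₂ (λ x y → 1ℚ · x + t · y)
           (trans (var-*ₚ-suc a₀ Q (incr a₀ I) (lookup-incr-≡ a₀ I))
                  (trans (cong Q (decr-incr a₀ I)) (proj₁ Q-monic)))
           (var-*ₚ-zero b₀ Q (incr a₀ I) b₀∉a₀I) ⟩
    1ℚ · 1ℚ + t · 0ℚ                                            ≡⟨ cong (1ℚ · 1ℚ +_) (*-zeroʳ t) ⟩
    1ℚ                                                          ∎
    where open ≡-Reasoning

  var-*ₚ-below : ∀ i → (∀ β {m} → β ≺ incr a₀ I → lookup β i ≡ suc m → decr β i ≺ I) →
    ∀ β → β ≺ incr a₀ I → (var i *ₚ Q) β ≡ 0ℚ
  var-*ₚ-below i decr≺I β β≺a₀I with lookup β i in βᵢ
  ... | zero  = var-*ₚ-zero i Q β βᵢ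
  ... | suc m = trans (var-*ₚ-suc i Q β βᵢ) (proj₂ Q-monic _ (decr≺I β β≺a₀I βᵢ))

  below-leading : ∀ β → β ≺ incr a₀ I → NormalRoot (suc k) a b τ β ≡ 0ℚ
  below-leading β β≺a₀I = begin
    NormalRoot (suc k) a b τ β                 ≡⟨ linear-*ₚ 1ℚ t a₀ b₀ Q β ⟩
    1ℚ · (var a₀ *ₚ Q) β + t · (var b₀ *ₚ Q) β
      ≡⟨ cong₂ (λ x y → 1ℚ · x + t · y)
           (var-*ₚ-below a₀ (λ β β≺ βₐ → subst (decr β a₀ ≺_) (decr-incr a₀ I)
                                          (decr-≺ β (incr a₀ I) a₀ β≺ βₐ (lookup-incr-≡ a₀ I))) β β≺a₀I)
           (var-*ₚ-below b₀ (λ β β≺ _ → decr-≺-incr β I a₀ b₀ (a<b F.zero) β≺) β β≺a₀I) ⟩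
    1ℚ · 0ℚ + t · 0ℚ                           ≡⟨ cong (1ℚ · 0ℚ +_) (*-zeroʳ t) ⟩
    0ℚ                                         ∎
    where open ≡-Reasoning

unit-factor : ∀ s t x y → s · s ≡ 1ℚ → s · x + t · y ≡ s · (1ℚ · x + (s · t) · y)
unit-factor s t x y s²≡1 = begin
  s · x + t · y                   ≡⟨ cong (λ u → s · x + u) (sym (*-identityˡ (t · y))) ⟩
  s · x + 1ℚ · (t · y)            ≡⟨ cong (λ u → s · x + u · (t · y)) (sym s²≡1) ⟩
  s · x + (s · s) · (t · y)       ≡⟨ expand s t x y ⟩
  s · (1ℚ · x + (s · t) · y)      ∎
  where
  open ≡-Reasoning
  open +-*-Solver
  expand : ∀ s t x y → s · x + (s · s) · (t · y) ≡ s · (1ℚ · x + (s · t) · y)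
  expand = solve 4 (λ s t x y → s :* x :+ (s :* s) :* (t :* y) := s :* (con 1ℚ :* x :+ (s :* t) :* y)) refl

sign-factorˡ : ∀ σ τ x y → signℚ σ · x + signℚ τ · y ≡ signℚ σ · (1ℚ · x + signℚ (σ S.* τ) · y)
sign-factorˡ σ τ x y =
  trans (unit-factor (signℚ σ) (signℚ τ) x y (signℚ-sq σ))
        (cong (λ u → signℚ σ · (1ℚ · x + u · y)) (sym (signℚ-* σ τ)))

sign-factorʳ : ∀ σ τ x y → signℚ σ · x + signℚ τ · y ≡ signℚ τ · (1ℚ · y + signℚ (σ S.* τ) · x)
sign-factorʳ σ τ x y =
  trans (+-comm (signℚ σ · x) (signℚ τ · y))
        (trans (sign-factorˡ τ σ y x) (cong (λ s → signℚ τ · (1ℚ · y + signℚ s · x)) (Sₚ.*-comm τ σ)))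

-- Each factor σ x_a + τ x_b is rewritten as ε (x_lo + τ′ x_hi) with lo < hi.
module Normalise {k} (a b : Fin k → Fin n) (σ τ : Fin k → Sign) (d : Distinct a b) where

  pick : Bool → Fin k → Fin n
  pick x r = if x then a r else b r

  aFirst : Fin k → Bool
  aFirst r = isYes (a r F.<? b r)

  lo hi : Fin k → Fin n
  lo r = pick (aFirst r) r
  hi r = pick (not (aFirst r)) r

  ε τ′ : Fin k → Sign
  ε r = if aFirst r then σ r else τ r
  τ′ r = σ r S.* τ r

  pick-injective : ∀ x y r s → pick x r ≡ pick y s → r ≡ s
  pick-injective true  true  r s = proj₁ d r s
  pick-injective true  false r s = ⊥-elim ∘ proj₂ (proj₂ d) r s
  pick-injective false true  r s = ⊥-elim ∘ proj₂ (proj₂ d) s r ∘ sym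
  pick-injective false false r s = proj₁ (proj₂ d) r s

  lo<hi : ∀ r → lo r F.< hi r
  lo<hi r with a r F.<? b r
  ... | yes aᵣ<bᵣ = aᵣ<bᵣ
  ... | no aᵣ≮bᵣ with Fₚ.<-cmp (a r) (b r)
  ...   | tri< aᵣ<bᵣ _ _ = ⊥-elim (aᵣ≮bᵣ aᵣ<bᵣ)
  ...   | tri≈ _ aᵣ≡bᵣ _ = ⊥-elim (proj₂ (proj₂ d) r r aᵣ≡bᵣ)
  ...   | tri> _ _ bᵣ<aᵣ = bᵣ<aᵣ

  distinct : Distinct lo hi
  distinct = (λ r s → pick-injective _ _ r s) , (λ r s → pick-injective _ _ r s) , lo≢hi
    where
    lo≢hi : ∀ r s → lo r ≢ hi s
    lo≢hi r s loᵣ≡hiₛ with pick-injective _ _ r s loᵣ≡hiₛ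
    ... | refl = Fₚ.<⇒≢ (lo<hi r) loᵣ≡hiₛ

  factor : ∀ r → ((signℚ (σ r) ·ₚ var (a r)) +ₚ (signℚ (τ r) ·ₚ var (b r))) ≈ₚ
                 (signℚ (ε r) ·ₚ ((signℚ S.+ ·ₚ var (lo r)) +ₚ (signℚ (τ′ r) ·ₚ var (hi r))))
  factor r α with a r F.<? b r
  ... | yes _ = sign-factorˡ (σ r) (τ r) _ _
  ... | no _  = sign-factorʳ (σ r) (τ r) _ _

  normalise : rootProd k a b σ τ ≈ₚ (signℚ (signProd k ε) ·ₚ NormalRoot k lo hi τ′)
  normalise α = trans (prodP-cong k _ _ factor α) (prodP-scale k ε _ α)

Positive-resp-≈ₚ : ∀ {v w : Poly n} → v ≈ₚ w → Positive v → Positive w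
Positive-resp-≈ₚ v≈w (α , 0<vα , v-below≡0) =
  α , subst (0ℚ ℚ.<_) (v≈w α) 0<vα , λ β β≺α → trans (sym (v≈w β)) (v-below≡0 β β≺α)

signed-positive⇒≈ₚ : ∀ {I : Mono n} {P v} s → MonicAt I P → v ≈ₚ (signℚ s ·ₚ P) → Positive v → v ≈ₚ P
signed-positive⇒≈ₚ S.+ _     v≈P  _   β = trans (v≈P β) (*-identityˡ _)
signed-positive⇒≈ₚ S.- monic v≈-P pos = ⊥-elim (MonicAt⇒¬Positive-neg monic (Positive-resp-≈ₚ v≈-P pos))

IsNormalKRoot : ∀ k → Poly n → Set
IsNormalKRoot {n} k v =
  ∃ λ (a : Fin k → Fin n) → ∃ λ (b : Fin k → Fin n) → ∃ λ (τ : Fin k → Sign) →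
  Distinct a b × (∀ r → a r F.< b r) × (v ≈ₚ NormalRoot k a b τ)

normalKRoot⇒Positive : ∀ {k} {v : Poly n} → IsNormalKRoot k v → Positive v
normalKRoot⇒Positive {k = k} (a , b , τ , d , a<b , v≈root) =
  MonicAt⇒Positive (MonicAt-resp-≈ₚ v≈root (NormalRoot-monicAt k a b τ d a<b))

positiveKRoot⇒normal : ∀ {k} {v : Poly n} → IsKRoot k v → Positive v → IsNormalKRoot k v
positiveKRoot⇒normal {k = k} (a , b , σ , τ , d , v≈root) pos =
  lo , hi , τ′ , distinct , lo<hi ,
  signed-positive⇒≈ₚ (signProd k ε) (NormalRoot-monicAt k lo hi τ′ distinct lo<hi)
    (λ β → trans (v≈root β) (normalise β)) pos
  where open Normalise a b σ τ d

-- The bounds on n and k only ensure that k-roots exist; the equivalence holds for all n and k.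
lemma2p3 : (n k : ℕ) → 2 ≤ n → 0 < k → 2 * k ≤ n → (v : Poly n) → IsKRoot k v →
    (Positive v →
      ∃ λ (a : Fin k → Fin n) → ∃ λ (b : Fin k → Fin n) → ∃ λ (τ : Fin k → Sign) →
      Distinct a b × (∀ r → Data.Fin._<_ (a r) (b r)) × (v ≈ₚ rootProd k a b (λ _ → Sign.+) τ))
    × ((∃ λ (a : Fin k → Fin n) → ∃ λ (b : Fin k → Fin n) → ∃ λ (τ : Fin k → Sign) →
      Distinct a b × (∀ r → Data.Fin._<_ (a r) (b r)) × (v ≈ₚ rootProd k a b (λ _ → Sign.+) τ))
      → Positive v)
lemma2p3 n k _ _ _ v root = positiveKRoot⇒normal root , normalKRoot⇒Positive
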